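{- Let $p_1,\dots,p_r,q_1,\dots,q_s$ be distinct primes, $a_1,\dots,a_r$ and $b_1,\dots,b_s$ positive integers, and let $$n=\prod_{i=1}^r p_i^{2a_i+1}\prod_{j=1}^s q_j^{2b_j},\qquad n_1=\prod_{i=1}^r p_i^{2a_i+1}\prod_{j=1}^s q_j^{b_j-1},\qquad n_2=\prod_{j=1}^s q_j^{b_j+1}.$$ Suppose that $n_1$ is a harmonic number and $n_2$ is a unitary harmonic number. Then $n=n_1n_2$ is a bi-unitary harmonic number.
   Context: $\sigma(n)$, $d(n)$ denote the sum and number of positive divisors of $n$; $n$ is harmonic if $\sigma(n)\mid n\,d(n)$. A divisor $d$ of $n$ is a unitary divisor if $\gcd(d,n/d)=1$; $\sigma^*(n)$, $d^*(n)$ denote the sum and number of unitary divisors of $n$; $n$ is unitary harmonic if $\sigma^*(n)\mid n\,d^*(n)$. A divisor $d$ of $n$ is a bi-unitary divisor if the greatest common unitary divisor of $d$ and $n/d$ is $1$; $\sigma^{**}(n)$, $d^{**}(n)$ denote the sum and number of bi-unitary divisors of $n$; $n$ is bi-unitary harmonic if $\sigma^{**}(n)\mid n\,d^{**}(n)$. -}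

module Defs where

open import Data.Nat using (ℕ; zero; suc; _+_; _*_; _/_; _⊔_; _≟_)
open import Data.Nat.Divisibility using (_∣_; _∣?_)
open import Data.Nat.GCD using (gcd)
open import Data.Fin using (Fin)
import Data.Fin as Fin
open import Data.List using (List; applyUpTo; filter; length; foldr)
open import Data.Nat.ListAction using (sum)

prodF : {k : ℕ} → (Fin k → ℕ) → ℕ
prodF {zero}  f = 1
prodF {suc k} f = f Fin.zero * prodF (λ i → f (Fin.suc i))

-- n / d, with the convention n / 0 = 0 (only used for d ≥ 1)
quot : ℕ → ℕ → ℕ
quot n zero    = 0
quot n (suc k) = n / suc k

divisors : ℕ → List ℕ
divisors n = filter (_∣? n) (applyUpTo suc n)

unitaryDivisors : ℕ → List ℕ
unitaryDivisors n = filter (λ d → gcd d (quot n d) ≟ 1) (divisors n)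

gcud : ℕ → ℕ → ℕ
gcud a b = foldr _⊔_ 0
  (filter (λ e → gcd e (quot b e) ≟ 1) (filter (_∣? b) (unitaryDivisors a)))

biUnitaryDivisors : ℕ → List ℕ
biUnitaryDivisors n = filter (λ d → gcud d (quot n d) ≟ 1) (divisors n)

σ d σ* d* σ** d** : ℕ → ℕ
σ   n = sum (divisors n)
d   n = length (divisors n)
σ*  n = sum (unitaryDivisors n)
d*  n = length (unitaryDivisors n)
σ** n = sum (biUnitaryDivisors n)
d** n = length (biUnitaryDivisors n)

Harmonic UnitaryHarmonic BiUnitaryHarmonic : ℕ → Set
Harmonic n = σ n ∣ n * d n
UnitaryHarmonic n = σ* n ∣ n * d* n
BiUnitaryHarmonic n = σ** n ∣ n * d** n

module Submission where

-- The six arithmetic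
-- functions σ, d, σ*, d*, σ**, d** are multiplicative, so it suffices to compare them at
-- prime powers.  For an odd exponent every divisor of p^(2a+1) is bi-unitary, so σ** = σ and
-- d** = d there.  For an even exponent 2b the bi-unitary divisors of q^(2b) are the q^k with
-- k ≠ b, and these are exactly the products x y with x ∣ q^(b-1) and y ∈ {1, q^(b+1)}, the
-- unitary divisors of q^(b+1); hence σ**(q^2b) = σ(q^(b-1)) σ*(q^(b+1)), likewise for d**.
-- Multiplying out gives σ**(n) = σ(n₁) σ*(n₂) and d**(n) = d(n₁) d*(n₂), and then
-- σ(n₁) ∣ n₁ d(n₁) and σ*(n₂) ∣ n₂ d*(n₂) multiply to σ**(n) ∣ n d**(n).

open import Defs
open import Data.Nat using (ℕ; _≤_; _*_; _^_; _+_; _∸_)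
open import Data.Nat.Primality using (Prime)
open import Data.Fin using (Fin)
open import Data.Product using (_×_)
open import Function.Definitions using (Injective)
open import Relation.Binary.PropositionalEquality using (_≡_; _≢_)

open import Data.Nat using (_<_; _/_; _⊔_; zero; suc; z≤n; s≤s)
open import Data.Nat using (NonZero; ≢-nonZero; >-nonZero; nonTrivial⇒n>1; nonTrivial⇒≢1)
open import Data.Nat.Properties
open import Data.Nat.Divisibility
open import Data.Nat.DivMod using (m*n/n≡m; m/n*n≡m)
open import Data.Nat.GCD using (gcd; gcd[m,n]∣m; gcd[m,n]∣n; gcd-greatest; gcd[m,n]≡0⇒n≡0)
open import Data.Nat.Coprimality using (Coprime; coprime-divisor; coprime-/gcd; coprime⇒gcd≡1; gcd≡1⇒coprime)
import Data.Nat.Coprimality as Coprime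
open import Data.Nat.Primality using (prime⇒irreducible; prime⇒nonTrivial)
open import Data.Nat.ListAction using (sum)
open import Data.Nat.ListAction.Properties using (sum-++; sum-↭)
open import Data.Nat.Solver using (module +-*-Solver)
import Data.Fin as Fin
open import Data.Fin.Properties using () renaming (suc-injective to Fin-suc-injective)
open import Data.List using (List; []; _∷_; _++_; map; length; filter; applyUpTo; foldr; cartesianProductWith)
open import Data.List.Properties using (length-map; length-++)
open import Data.List.Membership.Propositional using (_∈_)
open import Data.List.Membership.Propositional.Properties
open import Data.List.Membership.Propositional.Properties.WithK using (unique∧set⇒bag)
open import Data.List.Relation.Unary.Any using (here; there)
import Data.List.Relation.Unary.All as All
open import Data.List.Relation.Unary.AllPairs using ([]; _∷_)
open import Data.List.Relation.Unary.Unique.Propositional using (Unique)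
import Data.List.Relation.Unary.Unique.Propositional.Properties as Unique
open import Data.List.Relation.Binary.Disjoint.Propositional using (Disjoint)
open import Data.List.Relation.Binary.BagAndSetEquality using (_∼[_]_; set; ∼bag⇒↭)
open import Data.List.Relation.Binary.Permutation.Propositional using (_↭_)
open import Data.List.Relation.Binary.Permutation.Propositional.Properties using (↭-length)
open import Data.Product using (∃; ∃₂; _,_; proj₁; proj₂)
open import Data.Sum using (_⊎_; inj₁; inj₂)
open import Data.Unit using (⊤; tt)
open import Data.Empty using (⊥-elim)
open import Function using (_∘_)
open import Function.Bundles using (mk⇔)
open import Relation.Binary.PropositionalEquality using (refl; sym; trans; cong; cong₂; subst; subst₂; module ≡-Reasoning)
open import Relation.Binary.Definitions using (tri<; tri≈; tri>)
open import Relation.Nullary using (¬_; yes; no)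
open +-*-Solver

products : List ℕ → List ℕ → List ℕ
products = cartesianProductWith _*_

sum-map-* : ∀ x ys → sum (map (x *_) ys) ≡ x * sum ys
sum-map-* x []       = sym (*-zeroʳ x)
sum-map-* x (y ∷ ys) = begin
  x * y + sum (map (x *_) ys) ≡⟨ cong (x * y +_) (sum-map-* x ys) ⟩
  x * y + x * sum ys          ≡⟨ *-distribˡ-+ x y (sum ys) ⟨
  x * (y + sum ys)            ∎
  where open ≡-Reasoning

sum-products : ∀ xs ys → sum (products xs ys) ≡ sum xs * sum ys
sum-products []       ys = refl
sum-products (x ∷ xs) ys = begin
  sum (map (x *_) ys ++ products xs ys)   ≡⟨ sum-++ (map (x *_) ys) _ ⟩
  sum (map (x *_) ys) + sum (products xs ys) ≡⟨ cong₂ _+_ (sum-map-* x ys) (sum-products xs ys) ⟩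
  x * sum ys + sum xs * sum ys            ≡⟨ *-distribʳ-+ (sum ys) x (sum xs) ⟨
  (x + sum xs) * sum ys                   ∎
  where open ≡-Reasoning

length-products : ∀ xs ys → length (products xs ys) ≡ length xs * length ys
length-products []       ys = refl
length-products (x ∷ xs) ys = begin
  length (map (x *_) ys ++ products xs ys)         ≡⟨ length-++ (map (x *_) ys) ⟩
  length (map (x *_) ys) + length (products xs ys) ≡⟨ cong₂ _+_ (length-map (x *_) ys) (length-products xs ys) ⟩
  length ys + length xs * length ys                ∎
  where open ≡-Reasoning

FirstFactorDetermined : List ℕ → List ℕ → Set
FirstFactorDetermined xs ys = ∀ {x x′ y y′} → x ∈ xs → x′ ∈ xs → y ∈ ys → y′ ∈ ys →
                              x * y ≡ x′ * y′ → x ≡ x′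

unique-products : ∀ {xs ys} → Unique xs → Unique ys → (∀ {x} → x ∈ xs → 1 ≤ x) →
                  FirstFactorDetermined xs ys → Unique (products xs ys)
unique-products {[]}     _              _   _   _  = []
unique-products {x ∷ xs} {ys} (x∉xs ∷ xs!) ys! pos det =
  Unique.++⁺ (Unique.map⁺ cancel ys!)
             (unique-products xs! ys! (λ x∈ → pos (there x∈)) (λ a b → det (there a) (there b)))
             disjoint
  where
  cancel : ∀ {y y′} → x * y ≡ x * y′ → y ≡ y′
  cancel {y} {y′} eq with pos (here refl)
  ... | s≤s _ = *-cancelˡ-≡ y y′ x eq
  disjoint : Disjoint (map (x *_) ys) (products xs ys)
  disjoint (v∈xys , v∈rest) with ∈-map⁻ (x *_) v∈xys | ∈-cartesianProductWith⁻ _*_ xs ys v∈rest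
  ... | y , y∈ , refl | x′ , y′ , x′∈ , y′∈ , eq =
    All.lookup x∉xs x′∈ (det (here refl) (there x′∈) y∈ y′∈ eq)

same-members⇒↭ : ∀ {xs ys : List ℕ} → Unique xs → Unique ys → xs ∼[ set ] ys → xs ↭ ys
same-members⇒↭ xs! ys! same = ∼bag⇒↭ (unique∧set⇒bag xs! ys! same)

-- L is, up to order, the list of all products of an element of xs with an element of ys.
record ProductDecomposition (L xs ys : List ℕ) : Set where
  field
    L!           : Unique L
    xs!          : Unique xs
    ys!          : Unique ys
    xs-positive  : ∀ {x} → x ∈ xs → 1 ≤ x
    first-factor : FirstFactorDetermined xs ys
    split        : ∀ {v} → v ∈ L → ∃₂ λ x y → x ∈ xs × y ∈ ys × v ≡ x * y
    join         : ∀ {x y} → x ∈ xs → y ∈ ys → x * y ∈ L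

decomposition-sum-length : ∀ {L xs ys} → ProductDecomposition L xs ys →
                           sum L ≡ sum xs * sum ys × length L ≡ length xs * length ys
decomposition-sum-length {L} {xs} {ys} D =
  trans (sum-↭ L↭) (sum-products xs ys) , trans (↭-length L↭) (length-products xs ys)
  where
  open ProductDecomposition D
  to : ∀ {v} → v ∈ L → v ∈ products xs ys
  to v∈L with split v∈L
  ... | x , y , x∈ , y∈ , refl = ∈-cartesianProductWith⁺ _*_ x∈ y∈
  from : ∀ {v} → v ∈ products xs ys → v ∈ L
  from v∈ with ∈-cartesianProductWith⁻ _*_ xs ys v∈
  ... | x , y , x∈ , y∈ , refl = join x∈ y∈
  L↭ : L ↭ products xs ys
  L↭ = same-members⇒↭ L! (unique-products xs! ys! xs-positive first-factor) (mk⇔ to from)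

coprime-∣ˡ : ∀ {m n k} → Coprime m n → k ∣ m → Coprime k n
coprime-∣ˡ co k∣m (i∣k , i∣n) = co (∣-trans i∣k k∣m , i∣n)

coprime-∣ʳ : ∀ {m n k} → Coprime m n → k ∣ n → Coprime m k
coprime-∣ʳ co k∣n (i∣m , i∣k) = co (i∣m , ∣-trans i∣k k∣n)

coprime-*ˡ : ∀ {a b c} → Coprime a c → Coprime b c → Coprime (a * b) c
coprime-*ˡ {a} ac bc {i} (i∣ab , i∣c) = bc (coprime-divisor (coprime-∣ˡ (Coprime.sym ac) i∣c) i∣ab , i∣c)

coprime-*ʳ : ∀ {a b c} → Coprime a b → Coprime a c → Coprime a (b * c)
coprime-*ʳ ab ac = Coprime.sym (coprime-*ˡ (Coprime.sym ab) (Coprime.sym ac))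

coprime-1 : ∀ a → Coprime a 1
coprime-1 a (_ , i∣1) = ∣1⇒≡1 i∣1

∣-positive : ∀ {x N} → 1 ≤ N → x ∣ N → 1 ≤ x
∣-positive {zero}  N≥1 x∣N = ≤-trans N≥1 (≤-reflexive (0∣⇒≡0 x∣N))
∣-positive {suc x} _   _   = s≤s z≤n

gcd-coprime-part : ∀ {m n y z} → Coprime m n → y ∣ m → z ∣ n → gcd (y * z) m ≡ y
gcd-coprime-part {m} {n} {y} {z} co y∣m z∣n = ∣-antisym g∣y (gcd-greatest (m∣m*n z) y∣m)
  where
  g : ℕ
  g = gcd (y * z) m
  g∣y : g ∣ y
  g∣y = coprime-divisor (coprime-∣ʳ (coprime-∣ˡ co (gcd[m,n]∣n (y * z) m)) z∣n)
                        (subst (g ∣_) (*-comm y z) (gcd[m,n]∣m (y * z) m))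

coprime-factorisation : ∀ {m n e} → 1 ≤ m → Coprime m n → e ∣ m * n →
                        ∃₂ λ y z → y ∣ m × z ∣ n × e ≡ y * z
coprime-factorisation {m} {n} {e} m≥1 co e∣mn = g , e / g , gcd[m,n]∣n e m , e/g∣n , e≡g*e/g
  where
  g : ℕ
  g = gcd e m
  instance
    g≢0 : NonZero g
    g≢0 = ≢-nonZero λ g≡0 → <⇒≢ m≥1 (sym (gcd[m,n]≡0⇒n≡0 e g≡0))
  e≡g*e/g : e ≡ g * (e / g)
  e≡g*e/g = sym (trans (*-comm g (e / g)) (m/n*n≡m (gcd[m,n]∣m e m)))
  mn≡ : m * n ≡ (m / g * n) * g
  mn≡ = begin
    m * n             ≡⟨ cong (_* n) (m/n*n≡m (gcd[m,n]∣n e m)) ⟨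
    (m / g * g) * n   ≡⟨ solve 3 (λ a b c → (a :* b) :* c := (a :* c) :* b) refl (m / g) g n ⟩
    (m / g * n) * g   ∎
    where open ≡-Reasoning
  e/g∣n : e / g ∣ n
  e/g∣n = coprime-divisor (coprime-/gcd e m)
            (*-cancelʳ-∣ g (subst₂ _∣_ (sym (m/n*n≡m (gcd[m,n]∣m e m))) mn≡ e∣mn))

quot-unique : ∀ {N k x} → 1 ≤ x → N ≡ k * x → quot N x ≡ k
quot-unique {x = suc x} _ refl = m*n/n≡m _ (suc x)

quot-*ʳ : ∀ {y m} → 1 ≤ y → y ∣ m → m ≡ quot m y * y
quot-*ʳ {y} {m} y≥1 (divides k m≡k*y) =
  trans m≡k*y (cong (_* y) (sym (quot-unique {m} {k} {y} y≥1 m≡k*y)))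

quot-∣ : ∀ {y m} → 1 ≤ y → y ∣ m → quot m y ∣ m
quot-∣ {y} {m} y≥1 y∣m = divides y (trans (quot-*ʳ y≥1 y∣m) (*-comm (quot m y) y))

quot-* : ∀ {m n y z} → 1 ≤ y → 1 ≤ z → y ∣ m → z ∣ n → quot (m * n) (y * z) ≡ quot m y * quot n z
quot-* {m} {n} {y} {z} y≥1 z≥1 y∣m z∣n = quot-unique (*-mono-≤ y≥1 z≥1) (begin
  m * n                             ≡⟨ cong₂ _*_ (quot-*ʳ y≥1 y∣m) (quot-*ʳ z≥1 z∣n) ⟩
  (quot m y * y) * (quot n z * z)
    ≡⟨ solve 4 (λ a b c d → (a :* b) :* (c :* d) := (a :* c) :* (b :* d)) refl (quot m y) y (quot n z) z ⟩
  (quot m y * quot n z) * (y * z)   ∎)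
  where open ≡-Reasoning

Unitary : ℕ → ℕ → Set
Unitary e m = e ∣ m × Coprime e (quot m e)

unitary-extend : ∀ {e m n} → 1 ≤ m → Coprime m n → Unitary e m → Unitary e (m * n)
unitary-extend {e} {m} {n} m≥1 co (e∣m , e⊥m/e) =
  ∣m⇒∣m*n n e∣m , subst (Coprime e) (sym quot≡) (coprime-*ʳ e⊥m/e (coprime-∣ˡ co e∣m))
  where
  e≥1 : 1 ≤ e
  e≥1 = ∣-positive m≥1 e∣m
  quot≡ : quot (m * n) e ≡ quot m e * n
  quot≡ = quot-unique e≥1 (begin
    m * n              ≡⟨ cong (_* n) (quot-*ʳ e≥1 e∣m) ⟩
    (quot m e * e) * n ≡⟨ solve 3 (λ q e n → (q :* e) :* n := (q :* n) :* e) refl (quot m e) e n ⟩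
    (quot m e * n) * e ∎)
    where open ≡-Reasoning

unitary-split : ∀ {m n y z} → 1 ≤ m → 1 ≤ n → y ∣ m → z ∣ n → Unitary (y * z) (m * n) →
                Unitary y m × Unitary z n
unitary-split {m} {n} {y} {z} m≥1 n≥1 y∣m z∣n (_ , yz⊥) =
  (y∣m , λ (i∣y , i∣q) → yz⊥′ (∣m⇒∣m*n z i∣y , ∣m⇒∣m*n (quot n z) i∣q)) ,
  (z∣n , λ (i∣z , i∣q) → yz⊥′ (∣n⇒∣m*n y i∣z , ∣n⇒∣m*n (quot m y) i∣q))
  where
  yz⊥′ : Coprime (y * z) (quot m y * quot n z)
  yz⊥′ = subst (Coprime (y * z)) (quot-* (∣-positive m≥1 y∣m) (∣-positive n≥1 z∣n) y∣m z∣n) yz⊥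

unitary-join : ∀ {m n y z} → 1 ≤ m → 1 ≤ n → Coprime m n → Unitary y m → Unitary z n →
               Unitary (y * z) (m * n)
unitary-join {m} {n} {y} {z} m≥1 n≥1 co (y∣m , y⊥) (z∣n , z⊥) =
  *-pres-∣ y∣m z∣n ,
  subst (Coprime (y * z)) (sym (quot-* y≥1 z≥1 y∣m z∣n))
    (coprime-*ˡ (coprime-*ʳ y⊥ (coprime-∣ʳ (coprime-∣ˡ co y∣m) (quot-∣ z≥1 z∣n)))
                (coprime-*ʳ (coprime-∣ʳ (coprime-∣ˡ (Coprime.sym co) z∣n) (quot-∣ y≥1 y∣m)) z⊥))
  where
  y≥1 : 1 ≤ y
  y≥1 = ∣-positive m≥1 y∣m
  z≥1 : 1 ≤ z
  z≥1 = ∣-positive n≥1 z∣n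

NoCommonUnitary : ℕ → ℕ → Set
NoCommonUnitary a b = ∀ e → Unitary e a → Unitary e b → e ≤ 1

module _ {m n a a′ b b′} (m≥1 : 1 ≤ m) (n≥1 : 1 ≤ n) (co : Coprime m n)
         (a∣m : a ∣ m) (a′∣m : a′ ∣ m) (b∣n : b ∣ n) (b′∣n : b′ ∣ n) where

  private
    a≥1 : 1 ≤ a
    a≥1 = ∣-positive m≥1 a∣m
    a′≥1 : 1 ≤ a′
    a′≥1 = ∣-positive m≥1 a′∣m
    b≥1 : 1 ≤ b
    b≥1 = ∣-positive n≥1 b∣n
    b′≥1 : 1 ≤ b′
    b′≥1 = ∣-positive n≥1 b′∣n
    a⊥b : Coprime a b
    a⊥b = coprime-∣ʳ (coprime-∣ˡ co a∣m) b∣n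
    a′⊥b′ : Coprime a′ b′
    a′⊥b′ = coprime-∣ʳ (coprime-∣ˡ co a′∣m) b′∣n

  noCommonUnitary-split : NoCommonUnitary (a * b) (a′ * b′) →
                          NoCommonUnitary a a′ × NoCommonUnitary b b′
  noCommonUnitary-split none =
    (λ e ua ua′ → none e (unitary-extend a≥1 a⊥b ua) (unitary-extend a′≥1 a′⊥b′ ua′)) ,
    (λ e ub ub′ → none e (subst (Unitary e) (*-comm b a) (unitary-extend b≥1 (Coprime.sym a⊥b) ub))
                         (subst (Unitary e) (*-comm b′ a′) (unitary-extend b′≥1 (Coprime.sym a′⊥b′) ub′)))

  -- a common unitary divisor e of (a * b, a′ * b′) splits as e = y * z with y common
  -- to (a, a′) and z common to (b, b′), since both factorisations of e have the same
  -- m-part gcd(e, m) and n-part gcd(e, n)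
  noCommonUnitary-join : NoCommonUnitary a a′ → NoCommonUnitary b b′ →
                         NoCommonUnitary (a * b) (a′ * b′)
  noCommonUnitary-join noneᵃ noneᵇ e ue ue′
    with coprime-factorisation a≥1 a⊥b (proj₁ ue) | coprime-factorisation a′≥1 a′⊥b′ (proj₁ ue′)
  ... | y , z , y∣a , z∣b , refl | y′ , z′ , y′∣a′ , z′∣b′ , yz≡y′z′ =
    *-mono-≤ (noneᵃ y (proj₁ uy×uz) (subst (λ t → Unitary t a′) (sym y≡y′) (proj₁ uy′×uz′)))
             (noneᵇ z (proj₂ uy×uz) (subst (λ t → Unitary t b′) (sym z≡z′) (proj₂ uy′×uz′)))
    where
    y≡y′ : y ≡ y′
    y≡y′ = trans (sym (gcd-coprime-part co (∣-trans y∣a a∣m) (∣-trans z∣b b∣n)))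
                 (trans (cong (λ t → gcd t m) yz≡y′z′)
                        (gcd-coprime-part co (∣-trans y′∣a′ a′∣m) (∣-trans z′∣b′ b′∣n)))
    z≡z′ : z ≡ z′
    z≡z′ = trans (sym (gcd-coprime-part (Coprime.sym co) (∣-trans z∣b b∣n) (∣-trans y∣a a∣m)))
                 (trans (cong (λ t → gcd t n) (trans (*-comm z y) (trans yz≡y′z′ (*-comm y′ z′))))
                        (gcd-coprime-part (Coprime.sym co) (∣-trans z′∣b′ b′∣n) (∣-trans y′∣a′ a′∣m)))
    uy×uz : Unitary y a × Unitary z b
    uy×uz = unitary-split a≥1 b≥1 y∣a z∣b ue
    uy′×uz′ : Unitary y′ a′ × Unitary z′ b′
    uy′×uz′ = unitary-split a′≥1 b′≥1 y′∣a′ z′∣b′ (subst (λ t → Unitary t (a′ * b′)) yz≡y′z′ ue′)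

module _ {m n y z} (m≥1 : 1 ≤ m) (n≥1 : 1 ≤ n) (co : Coprime m n) (y∣m : y ∣ m) (z∣n : z ∣ n) where

  private
    y≥1 : 1 ≤ y
    y≥1 = ∣-positive m≥1 y∣m
    z≥1 : 1 ≤ z
    z≥1 = ∣-positive n≥1 z∣n
    cofactor≡ : quot (m * n) (y * z) ≡ quot m y * quot n z
    cofactor≡ = quot-* y≥1 z≥1 y∣m z∣n

  biUnitary-condition-split : NoCommonUnitary (y * z) (quot (m * n) (y * z)) →
                              NoCommonUnitary y (quot m y) × NoCommonUnitary z (quot n z)
  biUnitary-condition-split none =
    noCommonUnitary-split m≥1 n≥1 co y∣m (quot-∣ y≥1 y∣m) z∣n (quot-∣ z≥1 z∣n)
      (subst (NoCommonUnitary (y * z)) cofactor≡ none)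

  biUnitary-condition-join : NoCommonUnitary y (quot m y) → NoCommonUnitary z (quot n z) →
                             NoCommonUnitary (y * z) (quot (m * n) (y * z))
  biUnitary-condition-join noneʸ noneᶻ =
    subst (NoCommonUnitary (y * z)) (sym cofactor≡)
      (noCommonUnitary-join m≥1 n≥1 co y∣m (quot-∣ y≥1 y∣m) z∣n (quot-∣ z≥1 z∣n) noneʸ noneᶻ)

∈-divisors⁻ : ∀ {x N} → x ∈ divisors N → x ∣ N
∈-divisors⁻ {N = N} x∈ = proj₂ (∈-filter⁻ (_∣? N) {xs = applyUpTo suc N} x∈)

∈-divisors⁺ : ∀ {x N} → 1 ≤ N → x ∣ N → x ∈ divisors N
∈-divisors⁺ {zero}  {N}     N≥1 x∣N = ⊥-elim (<⇒≢ N≥1 (sym (0∣⇒≡0 x∣N)))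
∈-divisors⁺ {suc x} {suc N} _   x∣N = ∈-filter⁺ (_∣? suc N) (∈-applyUpTo⁺ suc (∣⇒≤ x∣N)) x∣N

divisors-unique : ∀ N → Unique (divisors N)
divisors-unique N = Unique.filter⁺ (_∣? N) (Unique.applyUpTo⁺₁ suc N (λ i<j _ → <⇒≢ i<j ∘ suc-injective))

∈-unitaryDivisors⁻ : ∀ {x N} → x ∈ unitaryDivisors N → Unitary x N
∈-unitaryDivisors⁻ {x} {N} x∈ with ∈-filter⁻ (λ k → gcd k (quot N k) ≟ 1) {xs = divisors N} x∈
... | x∈D , g≡1 = ∈-divisors⁻ x∈D , gcd≡1⇒coprime g≡1

∈-unitaryDivisors⁺ : ∀ {x N} → 1 ≤ N → Unitary x N → x ∈ unitaryDivisors N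
∈-unitaryDivisors⁺ {x} {N} N≥1 (x∣N , x⊥) =
  ∈-filter⁺ (λ k → gcd k (quot N k) ≟ 1) (∈-divisors⁺ N≥1 x∣N) (coprime⇒gcd≡1 x⊥)

commonUnitaryDivisors : ℕ → ℕ → List ℕ
commonUnitaryDivisors a b = filter (λ e → gcd e (quot b e) ≟ 1) (filter (_∣? b) (unitaryDivisors a))

∈-common⁻ : ∀ {e a b} → e ∈ commonUnitaryDivisors a b → Unitary e a × Unitary e b
∈-common⁻ {e} {a} {b} e∈ with ∈-filter⁻ (λ e → gcd e (quot b e) ≟ 1) {xs = filter (_∣? b) (unitaryDivisors a)} e∈
... | e∈′ , g≡1 with ∈-filter⁻ (_∣? b) {xs = unitaryDivisors a} e∈′
...   | e∈U , e∣b = ∈-unitaryDivisors⁻ e∈U , (e∣b , gcd≡1⇒coprime g≡1)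

∈-common⁺ : ∀ {e a b} → 1 ≤ a → Unitary e a → Unitary e b → e ∈ commonUnitaryDivisors a b
∈-common⁺ {e} {a} {b} a≥1 ua (e∣b , e⊥) =
  ∈-filter⁺ (λ e → gcd e (quot b e) ≟ 1) (∈-filter⁺ (_∣? b) (∈-unitaryDivisors⁺ a≥1 ua) e∣b) (coprime⇒gcd≡1 e⊥)

maximum : List ℕ → ℕ
maximum = foldr _⊔_ 0

≤-maximum : ∀ {x xs} → x ∈ xs → x ≤ maximum xs
≤-maximum {xs = y ∷ ys} (here refl) = m≤m⊔n y (maximum ys)
≤-maximum {xs = y ∷ ys} (there x∈)  = ≤-trans (≤-maximum x∈) (m≤n⊔m y (maximum ys))

maximum-≤ : ∀ {b} xs → (∀ {x} → x ∈ xs → x ≤ b) → maximum xs ≤ b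
maximum-≤ []       _   = z≤n
maximum-≤ (x ∷ xs) xs≤ = ⊔-lub (xs≤ (here refl)) (maximum-≤ xs (xs≤ ∘ there))

unitary-1 : ∀ a → Unitary 1 a
unitary-1 a = 1∣ a , Coprime.sym (coprime-1 _)

gcud≡1⇒noCommonUnitary : ∀ {a b} → gcud a b ≡ 1 → NoCommonUnitary a b
gcud≡1⇒noCommonUnitary {zero}    ()
gcud≡1⇒noCommonUnitary {a@(suc _)} {b} g≡1 e ua ub =
  subst (e ≤_) g≡1 (≤-maximum (∈-common⁺ (s≤s z≤n) ua ub))

noCommonUnitary⇒gcud≡1 : ∀ {a b} → 1 ≤ a → NoCommonUnitary a b → gcud a b ≡ 1
noCommonUnitary⇒gcud≡1 {a} {b} a≥1 none = ≤-antisym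
  (maximum-≤ (commonUnitaryDivisors a b) (λ e∈ → let (ua , ub) = ∈-common⁻ {a = a} e∈ in none _ ua ub))
  (≤-maximum (∈-common⁺ a≥1 (unitary-1 a) (unitary-1 b)))

BiUnitary : ℕ → ℕ → Set
BiUnitary x N = x ∣ N × NoCommonUnitary x (quot N x)

∈-biUnitaryDivisors⁻ : ∀ {x N} → x ∈ biUnitaryDivisors N → BiUnitary x N
∈-biUnitaryDivisors⁻ {x} {N} x∈ with ∈-filter⁻ (λ k → gcud k (quot N k) ≟ 1) {xs = divisors N} x∈
... | x∈D , g≡1 = ∈-divisors⁻ x∈D , gcud≡1⇒noCommonUnitary g≡1

∈-biUnitaryDivisors⁺ : ∀ {x N} → 1 ≤ N → BiUnitary x N → x ∈ biUnitaryDivisors N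
∈-biUnitaryDivisors⁺ {x} {N} N≥1 (x∣N , none) =
  ∈-filter⁺ (λ k → gcud k (quot N k) ≟ 1) (∈-divisors⁺ N≥1 x∣N)
            (noCommonUnitary⇒gcud≡1 (∣-positive N≥1 x∣N) none)

record DivisorNotion (F : ℕ → List ℕ) (C : ℕ → ℕ → Set) : Set where
  field
    unique   : ∀ N → Unique (F N)
    members⁻ : ∀ {x N} → x ∈ F N → x ∣ N × C x N
    members⁺ : ∀ {x N} → 1 ≤ N → x ∣ N → C x N → x ∈ F N
    split    : ∀ {m n y z} → 1 ≤ m → 1 ≤ n → Coprime m n → y ∣ m → z ∣ n →
               C (y * z) (m * n) → C y m × C z n
    join     : ∀ {m n y z} → 1 ≤ m → 1 ≤ n → Coprime m n → y ∣ m → z ∣ n →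
               C y m → C z n → C (y * z) (m * n)

notion-decomposition : ∀ {F C} → DivisorNotion F C → ∀ {m n} → 1 ≤ m → 1 ≤ n → Coprime m n →
                       ProductDecomposition (F (m * n)) (F m) (F n)
notion-decomposition {F} {C} D {m} {n} m≥1 n≥1 co = record
  { L! = unique (m * n) ; xs! = unique m ; ys! = unique n
  ; xs-positive  = λ x∈ → ∣-positive m≥1 (proj₁ (members⁻ x∈))
  ; first-factor = λ x∈ x′∈ y∈ y′∈ eq →
      trans (sym (gcd-coprime-part co (proj₁ (members⁻ x∈)) (proj₁ (members⁻ y∈))))
            (trans (cong (λ t → gcd t m) eq) (gcd-coprime-part co (proj₁ (members⁻ x′∈)) (proj₁ (members⁻ y′∈))))
  ; split = split′
  ; join  = λ x∈ y∈ → let (x∣m , Cx) = members⁻ x∈ ; (y∣n , Cy) = members⁻ y∈ in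
      members⁺ (*-mono-≤ m≥1 n≥1) (*-pres-∣ x∣m y∣n) (join m≥1 n≥1 co x∣m y∣n Cx Cy)
  }
  where
  open DivisorNotion D
  split′ : ∀ {v} → v ∈ F (m * n) → ∃₂ λ x y → x ∈ F m × y ∈ F n × v ≡ x * y
  split′ v∈ with members⁻ v∈
  ... | v∣mn , Cv with coprime-factorisation m≥1 co v∣mn
  ...   | y , z , y∣m , z∣n , refl with split m≥1 n≥1 co y∣m z∣n Cv
  ...     | Cy , Cz = y , z , members⁺ m≥1 y∣m Cy , members⁺ n≥1 z∣n Cz , refl

record Multiplicative (f : ℕ → ℕ) : Set where
  field
    one      : f 1 ≡ 1
    multiply : ∀ {m n} → 1 ≤ m → 1 ≤ n → Coprime m n → f (m * n) ≡ f m * f n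

notion-multiplicative : ∀ {F C} → DivisorNotion F C → F 1 ≡ 1 ∷ [] →
                        Multiplicative (λ N → sum (F N)) × Multiplicative (λ N → length (F N))
notion-multiplicative {F} D F1≡[1] =
  record { one = cong sum F1≡[1]    ; multiply = λ m≥1 n≥1 co → proj₁ (counts m≥1 n≥1 co) } ,
  record { one = cong length F1≡[1] ; multiply = λ m≥1 n≥1 co → proj₂ (counts m≥1 n≥1 co) }
  where
  counts : ∀ {m n} → 1 ≤ m → 1 ≤ n → Coprime m n →
           sum (F (m * n)) ≡ sum (F m) * sum (F n) × length (F (m * n)) ≡ length (F m) * length (F n)
  counts m≥1 n≥1 co = decomposition-sum-length (notion-decomposition D m≥1 n≥1 co)

divisorNotion : DivisorNotion divisors (λ _ _ → ⊤)
divisorNotion = record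
  { unique = divisors-unique
  ; members⁻ = λ x∈ → ∈-divisors⁻ x∈ , tt
  ; members⁺ = λ N≥1 x∣N _ → ∈-divisors⁺ N≥1 x∣N
  ; split = λ _ _ _ _ _ _ → tt , tt
  ; join = λ _ _ _ _ _ _ _ → tt
  }

unitaryNotion : DivisorNotion unitaryDivisors (λ x N → Coprime x (quot N x))
unitaryNotion = record
  { unique = λ N → Unique.filter⁺ (λ k → gcd k (quot N k) ≟ 1) (divisors-unique N)
  ; members⁻ = ∈-unitaryDivisors⁻
  ; members⁺ = λ N≥1 x∣N x⊥ → ∈-unitaryDivisors⁺ N≥1 (x∣N , x⊥)
  ; split = λ m≥1 n≥1 _ y∣m z∣n yz⊥ →
      let (uy , uz) = unitary-split m≥1 n≥1 y∣m z∣n (*-pres-∣ y∣m z∣n , yz⊥) in proj₂ uy , proj₂ uz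
  ; join = λ m≥1 n≥1 co y∣m z∣n y⊥ z⊥ → proj₂ (unitary-join m≥1 n≥1 co (y∣m , y⊥) (z∣n , z⊥))
  }

biUnitaryNotion : DivisorNotion biUnitaryDivisors (λ x N → NoCommonUnitary x (quot N x))
biUnitaryNotion = record
  { unique = λ N → Unique.filter⁺ (λ k → gcud k (quot N k) ≟ 1) (divisors-unique N)
  ; members⁻ = ∈-biUnitaryDivisors⁻
  ; members⁺ = λ N≥1 x∣N none → ∈-biUnitaryDivisors⁺ N≥1 (x∣N , none)
  ; split = biUnitary-condition-split
  ; join = biUnitary-condition-join
  }

σ-multiplicative : Multiplicative σ
σ-multiplicative = proj₁ (notion-multiplicative divisorNotion refl)
d-multiplicative : Multiplicative d
d-multiplicative = proj₂ (notion-multiplicative divisorNotion refl)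
σ*-multiplicative : Multiplicative σ*
σ*-multiplicative = proj₁ (notion-multiplicative unitaryNotion refl)
d*-multiplicative : Multiplicative d*
d*-multiplicative = proj₂ (notion-multiplicative unitaryNotion refl)
σ**-multiplicative : Multiplicative σ**
σ**-multiplicative = proj₁ (notion-multiplicative biUnitaryNotion refl)
d**-multiplicative : Multiplicative d**
d**-multiplicative = proj₂ (notion-multiplicative biUnitaryNotion refl)

primes-coprime : ∀ {p q} → Prime p → Prime q → p ≢ q → Coprime p q
primes-coprime p-prime q-prime p≢q {i} (i∣p , i∣q) with prime⇒irreducible p-prime i∣p
... | inj₁ i≡1 = i≡1
... | inj₂ refl with prime⇒irreducible q-prime i∣q
...   | inj₁ p≡1 = ⊥-elim (nonTrivial⇒≢1 {{prime⇒nonTrivial p-prime}} p≡1)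
...   | inj₂ p≡q = ⊥-elim (p≢q p≡q)

coprime-^ʳ : ∀ {a b} → Coprime a b → ∀ l → Coprime a (b ^ l)
coprime-^ʳ {a} _  zero    = coprime-1 a
coprime-^ʳ     co (suc l) = coprime-*ʳ co (coprime-^ʳ co l)

coprime-^ : ∀ {a b} → Coprime a b → ∀ k l → Coprime (a ^ k) (b ^ l)
coprime-^ co zero    l = Coprime.sym (coprime-1 _)
coprime-^ co (suc k) l = coprime-*ˡ (coprime-^ʳ co l) (coprime-^ co k l)

module PrimePower {p} (p-prime : Prime p) where

  p>1 : 1 < p
  p>1 = nonTrivial⇒n>1 p {{prime⇒nonTrivial p-prime}}

  instance
    p≢0 : NonZero p
    p≢0 = >-nonZero (<-trans (s≤s z≤n) p>1)

  ^-positive : ∀ k → 1 ≤ p ^ k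
  ^-positive k = ^-monoʳ-≤ p {0} {k} z≤n

  ^-injective : ∀ {i j} → p ^ i ≡ p ^ j → i ≡ j
  ^-injective {i} {j} eq with <-cmp i j
  ... | tri< i<j _ _ = ⊥-elim (<⇒≢ (^-monoʳ-< p p>1 i<j) eq)
  ... | tri≈ _ i≡j _ = i≡j
  ... | tri> _ _ j<i = ⊥-elim (<⇒≢ (^-monoʳ-< p p>1 j<i) (sym eq))

  ^-∣ : ∀ {i j} → i ≤ j → p ^ i ∣ p ^ j
  ^-∣ {i} {j} i≤j = divides (p ^ (j ∸ i)) (trans (cong (p ^_) (sym (m∸n+n≡m i≤j))) (^-distribˡ-+-* p (j ∸ i) i))

  quot-^ : ∀ {i e} → i ≤ e → quot (p ^ e) (p ^ i) ≡ p ^ (e ∸ i)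
  quot-^ {i} {e} i≤e = quot-unique (^-positive i)
    (trans (cong (p ^_) (sym (m∸n+n≡m i≤e))) (^-distribˡ-+-* p (e ∸ i) i))

  divisor-of-^ : ∀ {x} e → x ∣ p ^ e → ∃ λ i → i ≤ e × x ≡ p ^ i
  divisor-of-^ {x} zero    x∣1 = 0 , z≤n , ∣1⇒≡1 x∣1
  divisor-of-^ {x} (suc e) x∣pe with p ∣? x
  ... | yes (divides x′ refl) =
    let (i , i≤e , x′≡) = divisor-of-^ e (*-cancelʳ-∣ p (subst (x′ * p ∣_) (*-comm p (p ^ e)) x∣pe))
    in suc i , s≤s i≤e , trans (*-comm x′ p) (cong (p *_) x′≡)
  ... | no p∤x =
    let (i , i≤e , x≡) = divisor-of-^ e (coprime-divisor (Coprime.sym p⊥x) x∣pe)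
    in i , m≤n⇒m≤1+n i≤e , x≡
    where
    p⊥x : Coprime p x
    p⊥x (i∣p , i∣x) with prime⇒irreducible p-prime i∣p
    ... | inj₁ i≡1 = i≡1
    ... | inj₂ refl = ⊥-elim (p∤x i∣x)

  unitary-of-^ : ∀ {f e} → Unitary f (p ^ e) → f ≡ 1 ⊎ f ≡ p ^ e
  unitary-of-^ {f} {e} (f∣pe , f⊥) with divisor-of-^ e f∣pe
  ... | i , i≤e , refl with i | e ∸ i in e∸i≡
  ...   | zero   | _     = inj₁ refl
  ...   | suc i′ | zero  = inj₂ (cong (p ^_) (≤-antisym i≤e (m∸n≡0⇒m≤n e∸i≡)))
  ...   | suc i′ | suc r = ⊥-elim (nonTrivial⇒≢1 {{prime⇒nonTrivial p-prime}}
      (f⊥ (divides (p ^ i′) (*-comm p (p ^ i′)) ,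
           subst (p ∣_) (sym (trans (quot-^ i≤e) (cong (p ^_) e∸i≡))) (divides (p ^ r) (*-comm p (p ^ r))))))

  unitary-self : ∀ k → Unitary (p ^ k) (p ^ k)
  unitary-self k = ∣-refl ,
    subst (Coprime (p ^ k)) (sym (trans (quot-^ (≤-refl {k})) (cong (p ^_) (n∸n≡0 k)))) (coprime-1 (p ^ k))

  biUnitary-of-^ : ∀ {i e} → i ≤ e → i + i ≢ e → BiUnitary (p ^ i) (p ^ e)
  biUnitary-of-^ {i} {e} i≤e i+i≢e = ^-∣ i≤e , none
    where
    none : NoCommonUnitary (p ^ i) (quot (p ^ e) (p ^ i))
    none f uf uf′ with unitary-of-^ {e = i} uf | unitary-of-^ {e = e ∸ i} (subst (Unitary f) (quot-^ i≤e) uf′)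
    ... | inj₁ refl | _         = ≤-refl
    ... | _         | inj₁ refl = ≤-refl
    ... | inj₂ refl | inj₂ pi≡ = ⊥-elim (i+i≢e (trans (cong (i +_) (^-injective pi≡)) (m+[n∸m]≡n i≤e)))

  half-not-biUnitary : ∀ {b} → 1 ≤ b → ¬ BiUnitary (p ^ b) (p ^ (b + b))
  half-not-biUnitary {b} b≥1 (_ , none) =
    <⇒≱ (<-≤-trans p>1 (subst (_≤ p ^ b) (*-identityʳ p) (^-monoʳ-≤ p b≥1)))
        (none (p ^ b) (unitary-self b) (subst (Unitary (p ^ b)) (sym quot≡) (unitary-self b)))
    where
    quot≡ : quot (p ^ (b + b)) (p ^ b) ≡ p ^ b
    quot≡ = trans (quot-^ (m≤m+n b b)) (cong (p ^_) (m+n∸m≡n b b))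

-- For an odd exponent no divisor of p ^ e sits at half the exponent, so every
-- divisor is bi-unitary: σ** and d** agree with σ and d there.
biUnitary-odd-power : ∀ {p} → Prime p → ∀ a →
  σ** (p ^ (2 * a + 1)) ≡ σ (p ^ (2 * a + 1)) × d** (p ^ (2 * a + 1)) ≡ d (p ^ (2 * a + 1))
biUnitary-odd-power {p} p-prime a = sum-↭ all-biUnitary , ↭-length all-biUnitary
  where
  open PrimePower p-prime
  e : ℕ
  e = 2 * a + 1
  not-half : ∀ i → i + i ≢ e
  not-half i i+i≡e = even≢odd i a (trans (cong (i +_) (+-identityʳ i)) (trans i+i≡e (+-comm (2 * a) 1)))
  from : ∀ {x} → x ∈ divisors (p ^ e) → x ∈ biUnitaryDivisors (p ^ e)
  from x∈ with divisor-of-^ e (∈-divisors⁻ x∈)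
  ... | i , i≤e , refl = ∈-biUnitaryDivisors⁺ (^-positive e) (biUnitary-of-^ i≤e (not-half i))
  all-biUnitary : biUnitaryDivisors (p ^ e) ↭ divisors (p ^ e)
  all-biUnitary = same-members⇒↭ (DivisorNotion.unique biUnitaryNotion (p ^ e)) (divisors-unique (p ^ e))
    (mk⇔ (λ x∈ → ∈-divisors⁺ (^-positive e) (proj₁ (∈-biUnitaryDivisors⁻ x∈))) from)

-- Exponent bookkeeping for q ^ (2 * b) with b = suc c: the exponents k ≠ b, k ≤ 2 * b
-- are the i ≤ c (below b) and the i + (b + 1) with i ≤ c (above b).
module EvenExponent (c : ℕ) where
  E J : ℕ
  E = 2 * suc c
  J = suc c + 1

  E≡J+c : E ≡ J + c
  E≡J+c = solve 1 (λ c → con 2 :* (con 1 :+ c) := (con 1 :+ c :+ con 1) :+ c) refl c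

  E≡b+b : E ≡ suc c + suc c
  E≡b+b = solve 1 (λ c → con 2 :* (con 1 :+ c) := (con 1 :+ c) :+ (con 1 :+ c)) refl c

  low-≤ : ∀ {i} → i ≤ c → i ≤ E
  low-≤ {i} i≤c = subst (i ≤_) (sym E≡J+c) (≤-trans i≤c (m≤n+m c J))

  low-not-half : ∀ {i} → i ≤ c → i + i ≢ E
  low-not-half {i} i≤c i+i≡E = <⇒≢ (+-mono-< (s≤s i≤c) (s≤s i≤c)) (trans i+i≡E E≡b+b)

  high-≤ : ∀ {i} → i ≤ c → i + J ≤ E
  high-≤ {i} i≤c = subst (i + J ≤_) (trans (+-comm c J) (sym E≡J+c)) (+-monoˡ-≤ J i≤c)

  high-not-half : ∀ i → (i + J) + (i + J) ≢ E
  high-not-half i eq = <⇒≢ (<-≤-trans E<J+J (+-mono-≤ (m≤n+m J i) (m≤n+m J i))) (sym eq)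
    where
    b<J : suc c < J
    b<J = m<m+n (suc c) (s≤s z≤n)
    E<J+J : E < J + J
    E<J+J = subst (_< J + J) (sym E≡b+b) (+-mono-< b<J b<J)

  unshift-≤ : ∀ {k} → k ≤ E → k ∸ J ≤ c
  unshift-≤ {k} k≤E = subst (k ∸ J ≤_) (trans (cong (_∸ J) E≡J+c) (m+n∸m≡n J c)) (∸-monoˡ-≤ J k≤E)

even-power-decomposition : ∀ {q} → Prime q → ∀ c →
  ProductDecomposition (biUnitaryDivisors (q ^ (2 * suc c)))
                       (divisors (q ^ c)) (unitaryDivisors (q ^ (suc c + 1)))
even-power-decomposition {q} q-prime c = record
  { L! = DivisorNotion.unique biUnitaryNotion (q ^ E)
  ; xs! = divisors-unique (q ^ c)
  ; ys! = DivisorNotion.unique unitaryNotion (q ^ J)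
  ; xs-positive = xs-positive
  ; first-factor = first-factor
  ; split = split
  ; join = join
  }
  where
  open PrimePower q-prime
  open EvenExponent c

  xs-positive : ∀ {x} → x ∈ divisors (q ^ c) → 1 ≤ x
  xs-positive x∈ = ∣-positive (^-positive c) (∈-divisors⁻ x∈)

  -- every x ∣ q ^ c is smaller than q ^ (b + 1), so x * 1 never equals x′ * q ^ (b + 1)
  x<x′q^J : ∀ {x x′} → x ∈ divisors (q ^ c) → x′ ∈ divisors (q ^ c) → x < x′ * q ^ J
  x<x′q^J {x} {x′} x∈ x′∈ = begin-strict
    x        ≤⟨ ∣⇒≤ {{m^n≢0 q c}} (∈-divisors⁻ x∈) ⟩
    q ^ c    <⟨ ^-monoʳ-< q p>1 (≤-trans (n<1+n c) (m≤m+n (suc c) 1)) ⟩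
    q ^ J    ≤⟨ m≤n*m (q ^ J) x′ {{>-nonZero (xs-positive x′∈)}} ⟩
    x′ * q ^ J ∎
    where open ≤-Reasoning

  first-factor : FirstFactorDetermined (divisors (q ^ c)) (unitaryDivisors (q ^ J))
  first-factor {x} {x′} x∈ x′∈ y∈ y′∈ eq
    with unitary-of-^ {e = J} (∈-unitaryDivisors⁻ y∈) | unitary-of-^ {e = J} (∈-unitaryDivisors⁻ y′∈)
  ... | inj₁ refl | inj₁ refl = *-cancelʳ-≡ x x′ 1 eq
  ... | inj₂ refl | inj₂ refl = *-cancelʳ-≡ x x′ (q ^ J) {{m^n≢0 q J}} eq
  ... | inj₁ refl | inj₂ refl = ⊥-elim (<⇒≢ (x<x′q^J x∈ x′∈) (trans (sym (*-identityʳ x)) eq))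
  ... | inj₂ refl | inj₁ refl = ⊥-elim (<⇒≢ (x<x′q^J x′∈ x∈) (trans (sym (*-identityʳ x′)) (sym eq)))

  split : ∀ {v} → v ∈ biUnitaryDivisors (q ^ E) →
          ∃₂ λ x y → x ∈ divisors (q ^ c) × y ∈ unitaryDivisors (q ^ J) × v ≡ x * y
  split v∈ with ∈-biUnitaryDivisors⁻ v∈
  ... | v∣q^E , none with divisor-of-^ E v∣q^E
  ... | k , k≤E , refl with <-cmp k (suc c)
  ... | tri< k<b _ _ = q ^ k , 1 , ∈-divisors⁺ (^-positive c) (^-∣ (≤-pred k<b)) ,
                       ∈-unitaryDivisors⁺ (^-positive J) (unitary-1 (q ^ J)) , sym (*-identityʳ (q ^ k))
  ... | tri≈ _ refl _ = ⊥-elim (half-not-biUnitary {suc c} (s≤s z≤n)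
                          (subst (BiUnitary (q ^ suc c)) (cong (q ^_) E≡b+b) (v∣q^E , none)))
  ... | tri> _ _ b<k = q ^ (k ∸ J) , q ^ J , ∈-divisors⁺ (^-positive c) (^-∣ (unshift-≤ k≤E)) ,
                       ∈-unitaryDivisors⁺ (^-positive J) (unitary-self J) ,
                       trans (cong (q ^_) (sym (m∸n+n≡m J≤k))) (^-distribˡ-+-* q (k ∸ J) J)
    where
    J≤k : J ≤ k
    J≤k = subst (_≤ k) (+-comm 1 (suc c)) b<k

  join : ∀ {x y} → x ∈ divisors (q ^ c) → y ∈ unitaryDivisors (q ^ J) →
         x * y ∈ biUnitaryDivisors (q ^ E)
  join x∈ y∈ with divisor-of-^ c (∈-divisors⁻ x∈) | unitary-of-^ {e = J} (∈-unitaryDivisors⁻ y∈)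
  ... | i , i≤c , refl | inj₁ refl =
    subst (_∈ biUnitaryDivisors (q ^ E)) (sym (*-identityʳ (q ^ i)))
      (∈-biUnitaryDivisors⁺ (^-positive E) (biUnitary-of-^ (low-≤ i≤c) (low-not-half i≤c)))
  ... | i , i≤c , refl | inj₂ refl =
    subst (_∈ biUnitaryDivisors (q ^ E)) (^-distribˡ-+-* q i J)
      (∈-biUnitaryDivisors⁺ (^-positive E) (biUnitary-of-^ (high-≤ i≤c) (high-not-half i)))

biUnitary-even-power : ∀ {q} → Prime q → ∀ b → 1 ≤ b →
  σ** (q ^ (2 * b)) ≡ σ (q ^ (b ∸ 1)) * σ* (q ^ (b + 1)) ×
  d** (q ^ (2 * b)) ≡ d (q ^ (b ∸ 1)) * d* (q ^ (b + 1))
biUnitary-even-power q-prime (suc c) _ = decomposition-sum-length (even-power-decomposition q-prime c)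

prodF-cong : ∀ {k} {f g : Fin k → ℕ} → (∀ i → f i ≡ g i) → prodF f ≡ prodF g
prodF-cong {zero}  f≗g = refl
prodF-cong {suc k} f≗g = cong₂ _*_ (f≗g Fin.zero) (prodF-cong (λ i → f≗g (Fin.suc i)))

prodF-* : ∀ {k} (f g : Fin k → ℕ) → prodF (λ i → f i * g i) ≡ prodF f * prodF g
prodF-* {zero}  f g = refl
prodF-* {suc k} f g = begin
  (f₀ * g₀) * prodF (λ i → f′ i * g′ i)
    ≡⟨ cong ((f₀ * g₀) *_) (prodF-* f′ g′) ⟩
  (f₀ * g₀) * (prodF f′ * prodF g′)
    ≡⟨ solve 4 (λ a b c d → (a :* b) :* (c :* d) := (a :* c) :* (b :* d)) refl f₀ g₀ (prodF f′) (prodF g′) ⟩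
  (f₀ * prodF f′) * (g₀ * prodF g′) ∎
  where
  open ≡-Reasoning
  f₀ g₀ : ℕ
  f₀ = f Fin.zero
  g₀ = g Fin.zero
  f′ g′ : Fin k → ℕ
  f′ i = f (Fin.suc i)
  g′ i = g (Fin.suc i)

prodF-positive : ∀ {k} (f : Fin k → ℕ) → (∀ i → 1 ≤ f i) → 1 ≤ prodF f
prodF-positive {zero}  f f≥1 = ≤-refl
prodF-positive {suc k} f f≥1 =
  *-mono-≤ (f≥1 Fin.zero) (prodF-positive (λ i → f (Fin.suc i)) (λ i → f≥1 (Fin.suc i)))

coprime-prodF : ∀ {a k} (g : Fin k → ℕ) → (∀ j → Coprime a (g j)) → Coprime a (prodF g)
coprime-prodF {a} {zero}  g a⊥g = coprime-1 a
coprime-prodF {a} {suc k} g a⊥g =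
  coprime-*ʳ (a⊥g Fin.zero) (coprime-prodF (λ j → g (Fin.suc j)) (λ j → a⊥g (Fin.suc j)))

multiplicative-prodF : ∀ {f} → Multiplicative f → ∀ {k} (g : Fin k → ℕ) → (∀ i → 1 ≤ g i) →
                       (∀ i j → i ≢ j → Coprime (g i) (g j)) → f (prodF g) ≡ prodF (λ i → f (g i))
multiplicative-prodF M {zero}  g _   _      = Multiplicative.one M
multiplicative-prodF {f} M {suc k} g g≥1 g-pair = trans
  (Multiplicative.multiply M (g≥1 Fin.zero) (prodF-positive g′ (λ i → g≥1 (Fin.suc i)))
     (coprime-prodF g′ (λ j → g-pair Fin.zero (Fin.suc j) (λ ()))))
  (cong (f (g Fin.zero) *_) (multiplicative-prodF M g′ (λ i → g≥1 (Fin.suc i))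
     (λ i j i≢j → g-pair (Fin.suc i) (Fin.suc j) (i≢j ∘ Fin-suc-injective))))
  where
  g′ : Fin k → ℕ
  g′ i = g (Fin.suc i)

record DistinctPrimes {r s} (p : Fin r → ℕ) (q : Fin s → ℕ) : Set where
  field
    p-prime     : ∀ i → Prime (p i)
    q-prime     : ∀ j → Prime (q j)
    p-injective : Injective _≡_ _≡_ p
    q-injective : Injective _≡_ _≡_ q
    p≢q         : ∀ i j → p i ≢ q j

multiplicative-prime-powers : ∀ {f} → Multiplicative f → ∀ {k} {p : Fin k → ℕ} → (∀ i → Prime (p i)) →
  Injective _≡_ _≡_ p → (e : Fin k → ℕ) → f (prodF (λ i → p i ^ e i)) ≡ prodF (λ i → f (p i ^ e i))
multiplicative-prime-powers M {p = p} p-prime p-inj e =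
  multiplicative-prodF M (λ i → p i ^ e i) (λ i → PrimePower.^-positive (p-prime i) (e i))
    (λ i j i≢j → coprime-^ (primes-coprime (p-prime i) (p-prime j) (i≢j ∘ p-inj)) (e i) (e j))

module _ {r s} (p : Fin r → ℕ) (q : Fin s → ℕ) (a : Fin r → ℕ) (b : Fin s → ℕ) where
  n n₁ : ℕ
  n  = prodF (λ i → p i ^ (2 * a i + 1)) * prodF (λ j → q j ^ (2 * b j))
  n₁ = prodF (λ i → p i ^ (2 * a i + 1)) * prodF (λ j → q j ^ (b j ∸ 1))

n₂ : ∀ {s} → (Fin s → ℕ) → (Fin s → ℕ) → ℕ
n₂ q b = prodF (λ j → q j ^ (b j + 1))

even-exponent-split : ∀ ℓ b → 1 ≤ b → ℓ ^ (2 * b) ≡ ℓ ^ (b ∸ 1) * ℓ ^ (b + 1)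
even-exponent-split ℓ (suc c) _ =
  trans (cong (ℓ ^_) (solve 1 (λ c → con 2 :* (con 1 :+ c) := c :+ (con 1 :+ c :+ con 1)) refl c))
        (^-distribˡ-+-* ℓ c (suc c + 1))

n≡n₁*n₂ : ∀ {r s} (p : Fin r → ℕ) (q : Fin s → ℕ) (a : Fin r → ℕ) (b : Fin s → ℕ) → (∀ j → 1 ≤ b j) →
          n p q a b ≡ n₁ p q a b * n₂ q b
n≡n₁*n₂ p q a b b≥1 = begin
  P * prodF (λ j → q j ^ (2 * b j))
    ≡⟨ cong (P *_) (prodF-cong (λ j → even-exponent-split (q j) (b j) (b≥1 j))) ⟩
  P * prodF (λ j → q j ^ (b j ∸ 1) * q j ^ (b j + 1))
    ≡⟨ cong (P *_) (prodF-* (λ j → q j ^ (b j ∸ 1)) (λ j → q j ^ (b j + 1))) ⟩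
  P * (prodF (λ j → q j ^ (b j ∸ 1)) * n₂ q b)
    ≡⟨ *-assoc P (prodF (λ j → q j ^ (b j ∸ 1))) (n₂ q b) ⟨
  P * prodF (λ j → q j ^ (b j ∸ 1)) * n₂ q b ∎
  where
  open ≡-Reasoning
  P : ℕ
  P = prodF (λ i → p i ^ (2 * a i + 1))

factor-through-n₁n₂ : ∀ {S U V} → Multiplicative S → Multiplicative U → Multiplicative V →
  (∀ {ℓ} → Prime ℓ → ∀ a → S (ℓ ^ (2 * a + 1)) ≡ U (ℓ ^ (2 * a + 1))) →
  (∀ {ℓ} → Prime ℓ → ∀ b → 1 ≤ b → S (ℓ ^ (2 * b)) ≡ U (ℓ ^ (b ∸ 1)) * V (ℓ ^ (b + 1))) →
  ∀ {r s} {p : Fin r → ℕ} {q : Fin s → ℕ} → DistinctPrimes p q →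
  (a : Fin r → ℕ) (b : Fin s → ℕ) → (∀ j → 1 ≤ b j) →
  S (n p q a b) ≡ U (n₁ p q a b) * V (n₂ q b)
factor-through-n₁n₂ {S} {U} {V} MS MU MV odd even {r} {s} {p} {q} primes a b b≥1 = begin
  S (P odd-e * Q (λ j → 2 * b j))
    ≡⟨ on-P*Q MS odd-e (λ j → 2 * b j) ⟩
  prodF (λ i → S (p i ^ odd-e i)) * prodF (λ j → S (q j ^ (2 * b j)))
    ≡⟨ cong₂ _*_ (prodF-cong (λ i → odd (p-prime i) (a i)))
                 (trans (prodF-cong (λ j → even (q-prime j) (b j) (b≥1 j))) (prodF-* Uq Vq)) ⟩
  prodF (λ i → U (p i ^ odd-e i)) * (prodF Uq * prodF Vq)
    ≡⟨ *-assoc (prodF (λ i → U (p i ^ odd-e i))) (prodF Uq) (prodF Vq) ⟨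
  prodF (λ i → U (p i ^ odd-e i)) * prodF Uq * prodF Vq
    ≡⟨ cong₂ _*_ (on-P*Q MU odd-e (λ j → b j ∸ 1))
                 (multiplicative-prime-powers MV q-prime q-injective (λ j → b j + 1)) ⟨
  U (P odd-e * Q (λ j → b j ∸ 1)) * V (Q (λ j → b j + 1)) ∎
  where
  open ≡-Reasoning
  open DistinctPrimes primes
  odd-e : Fin r → ℕ
  odd-e i = 2 * a i + 1
  Uq Vq : Fin s → ℕ
  Uq j = U (q j ^ (b j ∸ 1))
  Vq j = V (q j ^ (b j + 1))
  P : (Fin r → ℕ) → ℕ
  P e = prodF (λ i → p i ^ e i)
  Q : (Fin s → ℕ) → ℕ
  Q e = prodF (λ j → q j ^ e j)
  P⊥Q : (e : Fin r → ℕ) (e′ : Fin s → ℕ) → Coprime (P e) (Q e′)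
  P⊥Q e e′ = coprime-prodF (λ j → q j ^ e′ j) (λ j → Coprime.sym (coprime-prodF (λ i → p i ^ e i) (λ i →
    Coprime.sym (coprime-^ (primes-coprime (p-prime i) (q-prime j) (p≢q i j)) (e i) (e′ j)))))
  on-P*Q : ∀ {f} → Multiplicative f → (e : Fin r → ℕ) (e′ : Fin s → ℕ) →
           f (P e * Q e′) ≡ prodF (λ i → f (p i ^ e i)) * prodF (λ j → f (q j ^ e′ j))
  on-P*Q M e e′ = trans
    (Multiplicative.multiply M (prodF-positive (λ i → p i ^ e i) (λ i → PrimePower.^-positive (p-prime i) (e i)))
                               (prodF-positive (λ j → q j ^ e′ j) (λ j → PrimePower.^-positive (q-prime j) (e′ j)))
                               (P⊥Q e e′))
    (cong₂ _*_ (multiplicative-prime-powers M p-prime p-injective e)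
               (multiplicative-prime-powers M q-prime q-injective e′))

biUnitary-sum-and-count : ∀ {r s} {p : Fin r → ℕ} {q : Fin s → ℕ} → DistinctPrimes p q →
  (a : Fin r → ℕ) (b : Fin s → ℕ) → (∀ j → 1 ≤ b j) →
  σ** (n p q a b) ≡ σ (n₁ p q a b) * σ* (n₂ q b) × d** (n p q a b) ≡ d (n₁ p q a b) * d* (n₂ q b)
biUnitary-sum-and-count primes a b b≥1 =
  factor-through-n₁n₂ σ**-multiplicative σ-multiplicative σ*-multiplicative
    (λ ℓ-prime a → proj₁ (biUnitary-odd-power ℓ-prime a))
    (λ ℓ-prime b b≥1 → proj₁ (biUnitary-even-power ℓ-prime b b≥1)) primes a b b≥1 ,
  factor-through-n₁n₂ d**-multiplicative d-multiplicative d*-multiplicative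
    (λ ℓ-prime a → proj₂ (biUnitary-odd-power ℓ-prime a))
    (λ ℓ-prime b b≥1 → proj₂ (biUnitary-even-power ℓ-prime b b≥1)) primes a b b≥1

biUnitaryHarmonic-product : ∀ {N N₁ N₂} → N ≡ N₁ * N₂ →
  σ** N ≡ σ N₁ * σ* N₂ → d** N ≡ d N₁ * d* N₂ →
  Harmonic N₁ → UnitaryHarmonic N₂ → BiUnitaryHarmonic N
biUnitaryHarmonic-product {N} {N₁} {N₂} N≡ σ**≡ d**≡ harmonic unitaryHarmonic =
  subst₂ _∣_ (sym σ**≡) N₁d₁N₂d₂≡ (*-pres-∣ harmonic unitaryHarmonic)
  where
  N₁d₁N₂d₂≡ : N₁ * d N₁ * (N₂ * d* N₂) ≡ N * d** N
  N₁d₁N₂d₂≡ = trans (solve 4 (λ x y z w → x :* y :* (z :* w) := x :* z :* (y :* w)) refl N₁ (d N₁) N₂ (d* N₂))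
                    (sym (cong₂ _*_ N≡ d**≡))

theorem5 : (r s : ℕ) (p : Fin r → ℕ) (q : Fin s → ℕ) (a : Fin r → ℕ) (b : Fin s → ℕ) →
    (∀ i → Prime (p i)) → (∀ j → Prime (q j)) →
    Injective _≡_ _≡_ p → Injective _≡_ _≡_ q → (∀ i j → p i ≢ q j) →
    (∀ i → 1 ≤ a i) → (∀ j → 1 ≤ b j) →
    Harmonic (prodF (λ i → p i ^ (2 * a i + 1)) * prodF (λ j → q j ^ (b j ∸ 1))) →
    UnitaryHarmonic (prodF (λ j → q j ^ (b j + 1))) →
    (prodF (λ i → p i ^ (2 * a i + 1)) * prodF (λ j → q j ^ (2 * b j))
    ≡ (prodF (λ i → p i ^ (2 * a i + 1)) * prodF (λ j → q j ^ (b j ∸ 1)))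
    * prodF (λ j → q j ^ (b j + 1)))
    × BiUnitaryHarmonic (prodF (λ i → p i ^ (2 * a i + 1)) * prodF (λ j → q j ^ (2 * b j)))
theorem5 r s p q a b p-prime q-prime p-inj q-inj p≢q _ b≥1 n₁-harmonic n₂-unitaryHarmonic =
  factorisation ,
  biUnitaryHarmonic-product {N₁ = n₁ p q a b} factorisation (proj₁ counts) (proj₂ counts)
                            n₁-harmonic n₂-unitaryHarmonic
  where
  factorisation : n p q a b ≡ n₁ p q a b * n₂ q b
  factorisation = n≡n₁*n₂ p q a b b≥1
  primes : DistinctPrimes p q
  primes = record { p-prime = p-prime ; q-prime = q-prime
                  ; p-injective = p-inj ; q-injective = q-inj ; p≢q = p≢q }
  counts : σ** (n p q a b) ≡ σ (n₁ p q a b) * σ* (n₂ q b) × d** (n p q a b) ≡ d (n₁ p q a b) * d* (n₂ q b)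
  counts = biUnitary-sum-and-count primes a b b≥1
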